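{- Let $f$ be an endomorphism of $\{a,b\}^*$ (with $a \prec b$) prolongable on $a$, such that $f^3(a)$ is a prefix of a Lyndon word, $f^\omega(a)$ begins with the word $ab^ia$ for some integer $i \geq 1$, and $f^\omega(a)$ is not periodic. Then $f(ab^i)$ is a power of a Lyndon word $u$ with $u \neq ab^i$. Moreover, if $i = 1$, then $|u| > |f(b)|$.
   Context: The lexicographic order $\prec$ on finite words over $\{a \prec b\}$: $u \prec v$ iff $u$ is a proper prefix of $v$, or $u = x\alpha y$, $v = x\beta z$ with letters $\alpha \prec \beta$. A non-empty finite word $w$ is a Lyndon word if $w \prec s$ for every non-empty proper suffix $s$ of $w$. A morphism $f$ is prolongable on $a$ if $f(a) = au$ for some word $u$ and $|f^n(a)| \to \infty$; then $f^\omega(a)$ denotes the unique infinite word having every $f^n(a)$ as a prefix. An infinite word is periodic if it equals $u^\omega$ for some non-empty finite word $u$. A power of $u$ means $u^n$ for an integer $n \ge 1$; $|w|$ is the length of $w$. -}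

module Defs where

open import Data.Nat using (ℕ; zero; suc; _+_; _<_; _≤_; NonZero)
open import Data.Nat.DivMod using (_%_; m%n<n)
open import Data.List using (List; []; _∷_; _++_; length; concatMap; replicate)
open import Data.Fin using (Fin; fromℕ<)
open import Data.Product using (Σ; ∃; _×_; _,_)
open import Relation.Binary.PropositionalEquality using (_≡_; _≢_)
open import Relation.Nullary using (¬_)

data Letter : Set where
  a b : Letter

data _<L_ : Letter → Letter → Set where
  a<b : a <L b

Word : Set
Word = List Letter

data _≺_ : Word → Word → Set where
  []≺∷  : ∀ {x v} → [] ≺ (x ∷ v)
  ∷≺∷   : ∀ {x u v} → u ≺ v → (x ∷ u) ≺ (x ∷ v)
  diff≺ : ∀ {α β u v} → α <L β → (α ∷ u) ≺ (β ∷ v)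

NonEmpty : Word → Set
NonEmpty w = w ≢ []

IsPrefix : Word → Word → Set
IsPrefix p w = ∃ λ t → w ≡ p ++ t

IsProperSuffix : Word → Word → Set
IsProperSuffix s w = NonEmpty s × (∃ λ p → NonEmpty p × w ≡ p ++ s)

IsLyndon : Word → Set
IsLyndon w = NonEmpty w × (∀ s → IsProperSuffix s w → w ≺ s)

_^ʷ_ : Word → ℕ → Word
u ^ʷ zero = []
u ^ʷ suc n = u ++ (u ^ʷ n)

IsPowerOf : Word → Word → Set
IsPowerOf w u = ∃ λ n → 1 ≤ n × w ≡ u ^ʷ n

Morphism : Set
Morphism = Letter → Word

apply : Morphism → Word → Word
apply f w = concatMap f w

iter : Morphism → ℕ → Word → Word
iter f zero w = w
iter f (suc n) w = apply f (iter f n w)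

Prolongable : Morphism → Set
Prolongable f = (∃ λ u → f a ≡ a ∷ u)
              × (∀ N → ∃ λ n → ∀ m → n ≤ m → N ≤ length (iter f m (a ∷ [])))

InfWord : Set
InfWord = ℕ → Letter

IsPrefixInf : Word → InfWord → Set
IsPrefixInf p x = ∀ k → (lt : k < length p) → x k ≡ Data.List.lookup p (fromℕ< lt)

IsFixedPointFrom : Morphism → InfWord → Set
IsFixedPointFrom f x = ∀ n → IsPrefixInf (iter f n (a ∷ [])) x

IsPeriodic : InfWord → Set
IsPeriodic x = ∃ λ (u : Word) → Σ (NonZero (length u)) λ nz →
  ∀ k → x k ≡ Data.List.lookup u (fromℕ< (m%n<n k (length u) {{nz}}))

{-# OPTIONS --safe #-}
-- Call a word Preprime if no suffix starting at a positive position lies below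
-- it at a mismatch; prefixes of Lyndon words are Preprime, so f³(a) and f²(a)
-- are.  In a Preprime word beginning with a bⁱ a, every later a is followed by
-- at least i letters b (or by the end of the word); together with a case
-- analysis on |f(a)| this shows that f²(a) begins with (a bⁱ)², so that the
-- square of P = f(a bⁱ) is a prefix of f³(a).  A word whose square is Preprime
-- is a power of a Lyndon word u (split off a nontrivial self-conjugation and
-- recurse).  If u = a bⁱ then f maps powers of a bⁱ to powers of a bⁱ and
-- f^ω(a) = (a bⁱ)^ω would be periodic.
--
-- For i = 1 suppose |f(b)| ≥ |u| and write f(b) = w u^m′ with w a proper
-- suffix of u.  If w is empty, f(a) and f(b) are powers of u and f^ω(a) is
-- periodic; if w ends in a, then a is a border of u; if w ends in b, then
-- u = (ab)ᵏ b ⋯, so f³(a) begins with u^(km) w but has a later suffix beginning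
-- with u^(km) u, which is smaller since u < w.
module Submission where

open import Defs
open import Data.Nat using (ℕ; zero; suc; _+_; _*_; _<_; _≤_; z≤n; s≤s; _≤?_)
open import Data.Nat.Properties
open import Data.Nat.DivMod using (_%_; m%n<n; [m+n]%n≡m%n; m<n⇒m%n≡m)
open import Data.List using (List; []; _∷_; _++_; _∷ʳ_; length; replicate; take; drop; lookup; initLast; _∷ʳ′_)
open import Data.List.Properties using (length-++; ++-assoc; ++-identityʳ; ∷-injective; ∷-injectiveʳ; ++-conicalˡ; ++-conicalʳ; length-replicate; length-++-≤ˡ; length-++-≤ʳ; take++drop≡id; length-take; length-drop; ≡-dec; concatMap-++)
open import Data.List.Relation.Unary.All using (All; []; _∷_)
open import Data.List.Relation.Unary.All.Properties using (++⁺; ++⁻ˡ; ++⁻ʳ)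
open import Data.Fin using (Fin; toℕ; fromℕ<)
open import Data.Fin.Properties using (any?; toℕ<n; toℕ-fromℕ<; fromℕ<-cong)
open import Data.Product using (∃; ∃₂; _×_; _,_; proj₁; proj₂)
open import Data.Sum using (_⊎_; inj₁; inj₂)
open import Data.Empty using (⊥; ⊥-elim)
open import Data.Unit using (⊤; tt)
open import Function using (_∘_)
open import Relation.Binary.PropositionalEquality
open import Relation.Nullary using (¬_; Dec; yes; no)
open import Relation.Nullary.Decidable using (_×-dec_)

_≟ˡ_ : (x y : Letter) → Dec (x ≡ y)
a ≟ˡ a = yes refl
a ≟ˡ b = no λ ()
b ≟ˡ a = no λ ()
b ≟ˡ b = yes refl

nonEmpty⇒1≤length : ∀ {w : Word} → NonEmpty w → 1 ≤ length w
nonEmpty⇒1≤length {[]} w≢[] = ⊥-elim (w≢[] refl)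
nonEmpty⇒1≤length {_ ∷ _} _ = s≤s z≤n

1≤length⇒nonEmpty : ∀ {w : Word} → 1 ≤ length w → NonEmpty w
1≤length⇒nonEmpty {_ ∷ _} _ ()

++-nonEmptyˡ : ∀ (u v : Word) → NonEmpty u → NonEmpty (u ++ v)
++-nonEmptyˡ u v u≢[] = u≢[] ∘ ++-conicalˡ u v

++-nonEmptyʳ : ∀ (u v : Word) → NonEmpty v → NonEmpty (u ++ v)
++-nonEmptyʳ u v v≢[] = v≢[] ∘ ++-conicalʳ u v

∷ʳ-nonEmpty : ∀ (w : Word) c → NonEmpty (w ∷ʳ c)
∷ʳ-nonEmpty w c = ++-nonEmptyʳ w (c ∷ []) λ ()

prefix-length : ∀ {u v : Word} → IsPrefix u v → length u ≤ length v
prefix-length {u} (t , refl) = subst (length u ≤_) (sym (length-++ u)) (m≤m+n (length u) (length t))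

proper-prefix : ∀ {u w : Word} → IsPrefix u w → length u < length w → ∃ λ t → NonEmpty t × w ≡ u ++ t
proper-prefix {u} {w} (t , w≡ut) |u|<|w| = t , t≢[] , w≡ut
  where
  t≢[] : NonEmpty t
  t≢[] t≡[] = <-irrefl (sym (trans (cong length (trans w≡ut (cong (u ++_) t≡[]))) (cong length (++-identityʳ u)))) |u|<|w|

prefix-same-length⇒≡ : ∀ {u v : Word} → IsPrefix u v → length u ≡ length v → u ≡ v
prefix-same-length⇒≡ {u} (t , refl) |u|≡|ut| with t
... | [] = sym (++-identityʳ u)
... | _ ∷ _ = ⊥-elim (m≢1+m+n (length u) (trans |u|≡|ut| (trans (length-++ u) (+-suc (length u) _))))

++-length-< : ∀ (u t : Word) → NonEmpty t → length u < length (u ++ t)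
++-length-< u t t≢[] = subst (length u <_) (sym (length-++ u)) (m<m+n (length u) (nonEmpty⇒1≤length t≢[]))

suffix-shorter : ∀ {s v : Word} → IsProperSuffix s v → length s < length v
suffix-shorter {s} (_ , p , p≢[] , refl) =
  subst (length s <_) (sym (trans (length-++ p) (+-comm (length p) (length s))))
        (m<m+n (length s) (nonEmpty⇒1≤length p≢[]))

-- The lexicographic order at a mismatch

infix 4 _<ᵐ_

-- u <ᵐ v: u ≺ v is decided at a position where the two words differ.  Unlike
-- ≺, this survives extending either word on the right.
data _<ᵐ_ : Word → Word → Set where
  here  : ∀ {α β u v} → α <L β → α ∷ u <ᵐ β ∷ v
  there : ∀ {x u v} → u <ᵐ v → x ∷ u <ᵐ x ∷ v

<ᵐ-++ : ∀ {u v} s t → u <ᵐ v → u ++ s <ᵐ v ++ t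
<ᵐ-++ s t (here α<β) = here α<β
<ᵐ-++ s t (there u<v) = there (<ᵐ-++ s t u<v)

++-<ᵐ : ∀ w {u v} → u <ᵐ v → w ++ u <ᵐ w ++ v
++-<ᵐ [] u<v = u<v
++-<ᵐ (_ ∷ w) u<v = there (++-<ᵐ w u<v)

<ᵐ-nonEmpty : ∀ {u v} → u <ᵐ v → NonEmpty u
<ᵐ-nonEmpty (here _) ()
<ᵐ-nonEmpty (there _) ()

<ᵐ⇒≺ : ∀ {u v} → u <ᵐ v → u ≺ v
<ᵐ⇒≺ (here α<β) = diff≺ α<β
<ᵐ⇒≺ (there u<v) = ∷≺∷ (<ᵐ⇒≺ u<v)

≺⇒prefix⊎<ᵐ : ∀ {u v} → u ≺ v → IsPrefix u v ⊎ u <ᵐ v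
≺⇒prefix⊎<ᵐ ([]≺∷ {x} {v}) = inj₁ (x ∷ v , refl)
≺⇒prefix⊎<ᵐ (∷≺∷ u≺v) with ≺⇒prefix⊎<ᵐ u≺v
... | inj₁ (t , refl) = inj₁ (t , refl)
... | inj₂ u<v = inj₂ (there u<v)
≺⇒prefix⊎<ᵐ (diff≺ α<β) = inj₂ (here α<β)

≺⇒≯ᵐ : ∀ {u v} → u ≺ v → ¬ v <ᵐ u
≺⇒≯ᵐ (∷≺∷ u≺v) (here ())
≺⇒≯ᵐ (∷≺∷ u≺v) (there v<u) = ≺⇒≯ᵐ u≺v v<u
≺⇒≯ᵐ (diff≺ a<b) (here ())

prefix⇒≯ᵐ : ∀ {u v} → IsPrefix u v → ¬ v <ᵐ u
prefix⇒≯ᵐ {_ ∷ _} (_ , refl) (here ())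
prefix⇒≯ᵐ {_ ∷ _} (t , refl) (there v<u) = prefix⇒≯ᵐ (t , refl) v<u

data Comparison (u v : Word) : Set where
  less      : u <ᵐ v → Comparison u v
  greater   : v <ᵐ u → Comparison u v
  prefix    : IsPrefix u v → Comparison u v
  extension : IsPrefix v u → Comparison u v

compare-∷ : ∀ c {u v} → Comparison u v → Comparison (c ∷ u) (c ∷ v)
compare-∷ c (less u<v) = less (there u<v)
compare-∷ c (greater v<u) = greater (there v<u)
compare-∷ c (prefix (t , refl)) = prefix (t , refl)
compare-∷ c (extension (t , refl)) = extension (t , refl)

compare : ∀ u v → Comparison u v
compare [] v = prefix (v , refl)
compare (x ∷ u) [] = extension (x ∷ u , refl)
compare (a ∷ u) (b ∷ v) = less (here a<b)
compare (b ∷ u) (a ∷ v) = greater (here a<b)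
compare (a ∷ u) (a ∷ v) = compare-∷ a (compare u v)
compare (b ∷ u) (b ∷ v) = compare-∷ b (compare u v)

++-equidivisible : ∀ (X B Y C : Word) → X ++ B ≡ Y ++ C →
  (∃ λ t → X ≡ Y ++ t × C ≡ t ++ B) ⊎ (∃ λ t → Y ≡ X ++ t × B ≡ t ++ C)
++-equidivisible [] B Y C e = inj₂ (Y , refl , e)
++-equidivisible (x ∷ X) B [] C e = inj₁ (x ∷ X , refl , sym e)
++-equidivisible (x ∷ X) B (y ∷ Y) C e with ∷-injective e
... | refl , e′ with ++-equidivisible X B Y C e′
... | inj₁ (t , refl , C≡tB) = inj₁ (t , refl , C≡tB)
... | inj₂ (t , refl , B≡tC) = inj₂ (t , refl , B≡tC)

^ʷ-+ : ∀ z m n → z ^ʷ (m + n) ≡ z ^ʷ m ++ z ^ʷ n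
^ʷ-+ z zero n = refl
^ʷ-+ z (suc m) n = trans (cong (z ++_) (^ʷ-+ z m n)) (sym (++-assoc z (z ^ʷ m) (z ^ʷ n)))

^ʷ-* : ∀ z m n → (z ^ʷ m) ^ʷ n ≡ z ^ʷ (n * m)
^ʷ-* z m zero = refl
^ʷ-* z m (suc n) = trans (cong (z ^ʷ m ++_) (^ʷ-* z m n)) (sym (^ʷ-+ z m (n * m)))

^ʷ-suc : ∀ z n → z ^ʷ suc n ≡ z ^ʷ n ++ z
^ʷ-suc z n = trans (cong (z ^ʷ_) (+-comm 1 n)) (trans (^ʷ-+ z n 1) (cong (z ^ʷ n ++_) (++-identityʳ z)))

IsPowerOf-++ : ∀ {u v z} → IsPowerOf u z → IsPowerOf v z → IsPowerOf (u ++ v) z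
IsPowerOf-++ {z = z} (m , 1≤m , refl) (n , _ , refl) = m + n , ≤-trans 1≤m (m≤m+n m n) , sym (^ʷ-+ z m n)

IsPowerOf-nonEmpty : ∀ {u z} → IsPowerOf u z → NonEmpty u → NonEmpty z
IsPowerOf-nonEmpty {z = []} (n , _ , refl) u≢[] = ⊥-elim (u≢[] ([]^ʷ n))
  where
  []^ʷ : ∀ n → [] ^ʷ n ≡ []
  []^ʷ zero = refl
  []^ʷ (suc n) = []^ʷ n
IsPowerOf-nonEmpty {z = _ ∷ _} _ _ ()

shrink-fuel : ∀ m k n → 1 ≤ k → m + k ≤ suc n → m ≤ n
shrink-fuel m k n 1≤k le = ≤-pred (≤-trans (≤-reflexive (+-comm 1 m)) (≤-trans (+-monoʳ-≤ m 1≤k) le))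

commuting⇒common-root : ∀ (p s : Word) → NonEmpty p → NonEmpty s → p ++ s ≡ s ++ p →
  ∃ λ z → IsPowerOf p z × IsPowerOf s z
commuting⇒common-root p s = go (length p + length s) p s ≤-refl
  where
  go : ∀ n (p s : Word) → length p + length s ≤ n → NonEmpty p → NonEmpty s → p ++ s ≡ s ++ p →
    ∃ λ z → IsPowerOf p z × IsPowerOf s z
  go zero p s le p≢[] _ _ = ⊥-elim (<⇒≱ (nonEmpty⇒1≤length p≢[]) (≤-trans (m≤m+n (length p) (length s)) le))
  go (suc n) p s le p≢[] s≢[] ps≡sp with ++-equidivisible p s s p ps≡sp
  ... | inj₁ ([] , p≡s[] , _) = s , (1 , ≤-refl , p≡s[]) , (1 , ≤-refl , sym (++-identityʳ s))
  ... | inj₂ ([] , s≡p[] , _) = p , (1 , ≤-refl , sym (++-identityʳ p)) , (1 , ≤-refl , s≡p[])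
  ... | inj₁ (t@(_ ∷ _) , refl , p≡ts)
    with go n s t shorter s≢[] (λ ()) p≡ts
    where
    shorter : length s + length t ≤ n
    shorter = shrink-fuel _ (length s) n (nonEmpty⇒1≤length s≢[]) (subst (λ k → k + length s ≤ suc n) (length-++ s) le)
  ... | z , s^ , t^ = z , IsPowerOf-++ s^ t^ , s^
  go (suc n) p s le p≢[] s≢[] ps≡sp | inj₂ (t@(_ ∷ _) , refl , s≡tp)
    with go n p t shorter p≢[] (λ ()) s≡tp
    where
    shorter : length p + length t ≤ n
    shorter = shrink-fuel _ (length p) n (nonEmpty⇒1≤length p≢[])
                (subst (_≤ suc n) (trans (cong (length p +_) (length-++ p)) (+-comm (length p) _)) le)
  ... | z , p^ , t^ = z , p^ , IsPowerOf-++ p^ t^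

-- Squares that are prefixes of Lyndon words

take-length-++ : ∀ (p s : Word) → take (length p) (p ++ s) ≡ p
take-length-++ [] s = refl
take-length-++ (c ∷ p) s = cong (c ∷_) (take-length-++ p s)

drop-length-++ : ∀ (p s : Word) → drop (length p) (p ++ s) ≡ s
drop-length-++ [] s = refl
drop-length-++ (c ∷ p) s = drop-length-++ p s

SelfConjugate : Word → Set
SelfConjugate u = ∃₂ λ p s → NonEmpty p × NonEmpty s × u ≡ p ++ s × u ≡ s ++ p

selfConjugate? : ∀ u → Dec (SelfConjugate u)
selfConjugate? u with any? (λ (k : Fin (length u)) →
  (1 ≤? toℕ k) ×-dec ≡-dec _≟ˡ_ (drop (toℕ k) u ++ take (toℕ k) u) u)
... | yes (k , 1≤k , rotation) =
  yes (take (toℕ k) u , drop (toℕ k) u , 1≤length⇒nonEmpty |take| , 1≤length⇒nonEmpty |drop| ,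
       sym (take++drop≡id (toℕ k) u) , sym rotation)
  where
  |take| : 1 ≤ length (take (toℕ k) u)
  |take| = subst (1 ≤_) (sym (trans (length-take (toℕ k) u) (m≤n⇒m⊓n≡m (<⇒≤ (toℕ<n k))))) 1≤k
  |drop| : 1 ≤ length (drop (toℕ k) u)
  |drop| = subst (1 ≤_) (sym (length-drop (toℕ k) u)) (m<n⇒0<n∸m (toℕ<n k))
... | no no-rotation = no λ where
  (p , s , p≢[] , s≢[] , refl , ps≡sp) → no-rotation (fromℕ< (suffix-shorter (p≢[] , s , s≢[] , ps≡sp)) ,
    subst (λ k → 1 ≤ k × drop k (p ++ s) ++ take k (p ++ s) ≡ p ++ s)
          (sym (toℕ-fromℕ< (suffix-shorter (p≢[] , s , s≢[] , ps≡sp))))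
          (nonEmpty⇒1≤length p≢[] ,
           trans (cong₂ _++_ (drop-length-++ p s) (take-length-++ p s)) (sym ps≡sp)))

Preprime : Word → Set
Preprime w = ∀ p s → w ≡ p ++ s → NonEmpty p → ¬ s <ᵐ w

Preprime-prefix : ∀ {w u} → IsPrefix w u → Preprime u → Preprime w
Preprime-prefix (t , refl) pre p s refl p≢[] s<w = pre p (s ++ t) (++-assoc p s t) p≢[] (<ᵐ-++ t t s<w)

Lyndon⇒Preprime : ∀ {L} → IsLyndon L → Preprime L
Lyndon⇒Preprime (_ , minimal) p s refl p≢[] s<L =
  ≺⇒≯ᵐ (minimal s (<ᵐ-nonEmpty s<L , p , p≢[] , refl)) s<L

Lyndon-<ᵐ-suffix : ∀ {v s} → IsLyndon v → IsProperSuffix s v → v <ᵐ s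
Lyndon-<ᵐ-suffix (_ , minimal) suffix with ≺⇒prefix⊎<ᵐ (minimal _ suffix)
... | inj₁ v⊑s = ⊥-elim (<⇒≱ (suffix-shorter suffix) (prefix-length v⊑s))
... | inj₂ v<s = v<s

Lyndon-unbordered : ∀ {v s} → IsLyndon v → IsProperSuffix s v → ¬ IsPrefix s v
Lyndon-unbordered ly suffix s⊑v = prefix⇒≯ᵐ s⊑v (Lyndon-<ᵐ-suffix ly suffix)

conjugate-length : ∀ (p s t : Word) → p ++ s ≡ s ++ t → length p ≡ length t
conjugate-length p s t ps≡st = +-cancelʳ-≡ (length s) (length p) (length t) (begin
  length p + length s  ≡⟨ length-++ p ⟨
  length (p ++ s)      ≡⟨ cong length ps≡st ⟩
  length (s ++ t)      ≡⟨ length-++ s ⟩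
  length s + length t  ≡⟨ +-comm (length s) (length t) ⟩
  length t + length s  ∎)
  where open ≡-Reasoning

-- With u = p s = s t: p = t makes u self-conjugate, and otherwise comparing p
-- with t exhibits a suffix of u u that lies below u u.
square-Preprime⇒suffix-above : ∀ {u s} → Preprime (u ++ u) → ¬ SelfConjugate u → IsProperSuffix s u → u ≺ s
square-Preprime⇒suffix-above {u} {s} pre ¬conj (s≢[] , p , p≢[] , refl) with compare u s
... | less u<s = <ᵐ⇒≺ u<s
... | greater s<u = ⊥-elim (pre p (s ++ u) (++-assoc p s u) p≢[] (<ᵐ-++ u u s<u))
... | prefix u⊑s = ⊥-elim (<⇒≱ (suffix-shorter (s≢[] , p , p≢[] , refl)) (prefix-length u⊑s))
... | extension (t , u≡st) with compare p t
...   | less p<t = ⊥-elim (pre p (s ++ u) (++-assoc p s u) p≢[]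
                   (subst (s ++ u <ᵐ_) uu≡s[tu] (++-<ᵐ s (<ᵐ-++ s u p<t))))
  where
  uu≡s[tu] : s ++ (t ++ u) ≡ u ++ u
  uu≡s[tu] = trans (sym (++-assoc s t u)) (cong (_++ u) (sym u≡st))
...   | greater t<p = ⊥-elim (pre s (t ++ u) uu≡s[tu] s≢[]
                      (subst (t ++ u <ᵐ_) (sym (++-assoc p s u)) (<ᵐ-++ u (s ++ u) t<p)))
  where
  uu≡s[tu] : u ++ u ≡ s ++ (t ++ u)
  uu≡s[tu] = trans (cong (_++ u) u≡st) (++-assoc s t u)
...   | prefix p⊑t = ⊥-elim (¬conj (p , s , p≢[] , s≢[] , refl ,
                   trans u≡st (cong (s ++_) (sym (prefix-same-length⇒≡ p⊑t (conjugate-length p s t u≡st))))))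
...   | extension t⊑p = ⊥-elim (¬conj (p , s , p≢[] , s≢[] , refl ,
                   trans u≡st (cong (s ++_) (prefix-same-length⇒≡ t⊑p (sym (conjugate-length p s t u≡st))))))

Lyndon⊎proper-power : ∀ u → NonEmpty u → Preprime (u ++ u) →
  IsLyndon u ⊎ ∃ λ z → NonEmpty z × ∃ λ j → u ≡ z ^ʷ (2 + j)
Lyndon⊎proper-power u u≢[] pre with selfConjugate? u
... | no ¬conj = inj₁ (u≢[] , λ s → square-Preprime⇒suffix-above pre ¬conj)
... | yes (p , s , p≢[] , s≢[] , refl , ps≡sp) with commuting⇒common-root p s p≢[] s≢[] ps≡sp
...   | z , p^@(suc α , _ , refl) , (suc β , _ , refl) =
  inj₂ (z , IsPowerOf-nonEmpty p^ p≢[] , α + β ,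
        trans (sym (^ʷ-+ z (suc α) (suc β))) (cong (λ k → z ^ʷ suc k) (+-suc α β)))

square-Preprime⇒Lyndon-power : ∀ u → NonEmpty u → Preprime (u ++ u) → ∃ λ v → IsLyndon v × IsPowerOf u v
square-Preprime⇒Lyndon-power u = go (length u) u ≤-refl
  where
  go : ∀ n u → length u ≤ n → NonEmpty u → Preprime (u ++ u) → ∃ λ v → IsLyndon v × IsPowerOf u v
  go n u |u|≤n u≢[] pre with Lyndon⊎proper-power u u≢[] pre
  ... | inj₁ lyndon = u , lyndon , 1 , ≤-refl , sym (++-identityʳ u)
  go zero u |u|≤n u≢[] pre | inj₂ _ = ⊥-elim (<⇒≱ (nonEmpty⇒1≤length u≢[]) |u|≤n)
  go (suc n) u |u|≤n u≢[] pre | inj₂ (z , z≢[] , j , refl)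
    with go n z |z|≤n z≢[] (Preprime-prefix (z ^ʷ j ++ u , zz-prefix) pre)
    where
    |z|≤n : length z ≤ n
    |z|≤n = ≤-pred (≤-trans (++-length-< z (z ++ z ^ʷ j) (++-nonEmptyˡ z (z ^ʷ j) z≢[])) |u|≤n)
    zz-prefix : u ++ u ≡ (z ++ z) ++ (z ^ʷ j ++ u)
    zz-prefix = trans (++-assoc z _ u) (trans (cong (z ++_) (++-assoc z (z ^ʷ j) u)) (sym (++-assoc z z _)))
  ... | v , lyndon , m , 1≤m , refl = v , lyndon , (2 + j) * m , *-mono-≤ {1} {2 + j} (s≤s z≤n) 1≤m , ^ʷ-* v m (2 + j)

-- Prefixes of infinite words, and fixed points of morphisms

infix 4 _⊑_

-- IsPrefixInf by recursion on the word, which avoids arithmetic on Fin indices.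
_⊑_ : Word → InfWord → Set
[] ⊑ x = ⊤
c ∷ w ⊑ x = x 0 ≡ c × w ⊑ (λ k → x (suc k))

IsPrefixInf⇒⊑ : ∀ w x → IsPrefixInf w x → w ⊑ x
IsPrefixInf⇒⊑ [] x _ = tt
IsPrefixInf⇒⊑ (c ∷ w) x w≤x = w≤x 0 (s≤s z≤n) , IsPrefixInf⇒⊑ w _ (λ k k< → w≤x (suc k) (s≤s k<))

⊑-prefix : ∀ {w u x} → IsPrefix w u → u ⊑ x → w ⊑ x
⊑-prefix {[]} _ _ = tt
⊑-prefix {c ∷ w} (t , refl) (x₀≡c , u⊑x) = x₀≡c , ⊑-prefix (t , refl) u⊑x

⊑-comparable : ∀ {w u x} → w ⊑ x → u ⊑ x → length w ≤ length u → IsPrefix w u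
⊑-comparable {[]} {u} _ _ _ = u , refl
⊑-comparable {c ∷ w} {d ∷ u} (x₀≡c , w⊑x) (x₀≡d , u⊑x) (s≤s |w|≤|u|) with trans (sym x₀≡c) x₀≡d
... | refl with ⊑-comparable w⊑x u⊑x |w|≤|u|
...   | t , refl = t , refl

⊑-agree : ∀ {w x y} → w ⊑ x → w ⊑ y → ∀ k → k < length w → x k ≡ y k
⊑-agree {c ∷ w} (x₀≡c , _) (y₀≡c , _) zero _ = trans x₀≡c (sym y₀≡c)
⊑-agree {c ∷ w} (_ , w⊑x) (_ , w⊑y) (suc k) (s≤s k<) = ⊑-agree w⊑x w⊑y k k<

⊑-resp-≗ : ∀ {w x y} → x ≗ y → w ⊑ x → w ⊑ y
⊑-resp-≗ {[]} _ _ = tt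
⊑-resp-≗ {c ∷ w} x≗y (x₀≡c , w⊑x) = trans (sym (x≗y 0)) x₀≡c , ⊑-resp-≗ (x≗y ∘ suc) w⊑x

⊑-++ : ∀ {w u x} → w ⊑ x → u ⊑ (λ k → x (length w + k)) → w ++ u ⊑ x
⊑-++ {[]} _ u⊑ = u⊑
⊑-++ {c ∷ w} (x₀≡c , w⊑x) u⊑ = x₀≡c , ⊑-++ w⊑x u⊑

cycle : ∀ z → InfWord
cycle z k = lookup (a ∷ z) (fromℕ< (m%n<n k (suc (length z))))

^ʷ-⊑-cycle : ∀ z r → (a ∷ z) ^ʷ r ⊑ cycle z
^ʷ-⊑-cycle z zero = tt
^ʷ-⊑-cycle z (suc r) = ⊑-++ {x = cycle z} period-⊑ (⊑-resp-≗ shift (^ʷ-⊑-cycle z r))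
  where
  period-⊑ : a ∷ z ⊑ cycle z
  period-⊑ = IsPrefixInf⇒⊑ (a ∷ z) (cycle z) λ k k< →
    cong (lookup (a ∷ z)) (fromℕ<-cong _ _ (m<n⇒m%n≡m k<) _ _)
  shift : cycle z ≗ (λ k → cycle z (suc (length z) + k))
  shift k = cong (lookup (a ∷ z)) (fromℕ<-cong _ _
    (sym (trans (cong (_% suc (length z)) (+-comm (suc (length z)) k)) ([m+n]%n≡m%n k (suc (length z))))) _ _)

apply-^ʷ : ∀ f z n → apply f (z ^ʷ n) ≡ apply f z ^ʷ n
apply-^ʷ f z zero = refl
apply-^ʷ f z (suc n) = trans (concatMap-++ f z (z ^ʷ n)) (cong (apply f z ++_) (apply-^ʷ f z n))

apply-replicate : ∀ f c n → apply f (replicate n c) ≡ f c ^ʷ n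
apply-replicate f c zero = refl
apply-replicate f c (suc n) = cong (f c ++_) (apply-replicate f c n)

apply-[_] : ∀ {f} c → apply f (c ∷ []) ≡ f c
apply-[_] {f} c = ++-identityʳ (f c)

apply-power : ∀ f z → (∀ c → ∃ λ r → f c ≡ z ^ʷ r) → ∀ w → ∃ λ r → apply f w ≡ z ^ʷ r
apply-power f z _ [] = 0 , refl
apply-power f z powers (c ∷ w) with powers c | apply-power f z powers w
... | r , fc≡ | s , fw≡ = r + s , trans (cong₂ _++_ fc≡ fw≡) (sym (^ʷ-+ z r s))

apply-All-b : ∀ f → All (_≡ b) (f b) → ∀ {w} → All (_≡ b) w → All (_≡ b) (apply f w)
apply-All-b f fb-b [] = []
apply-All-b f fb-b (refl ∷ w-b) = ++⁺ fb-b (apply-All-b f fb-b w-b)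

All-b-apply⁻ : ∀ f {w} → NonEmpty w → All (_≡ b) w → All (_≡ b) (apply f w) → All (_≡ b) (f b)
All-b-apply⁻ f {[]} w≢[] _ _ = ⊥-elim (w≢[] refl)
All-b-apply⁻ f {.b ∷ w} _ (refl ∷ _) fw-b = ++⁻ˡ (f b) fw-b

iter-prefix-suc : ∀ f {A'} → f a ≡ a ∷ A' → ∀ n → IsPrefix (iter f n (a ∷ [])) (iter f (suc n) (a ∷ []))
iter-prefix-suc f {A'} fa≡ zero = A' ++ [] , cong (_++ []) fa≡
iter-prefix-suc f fa≡ (suc n) with iter-prefix-suc f fa≡ n
... | t , next≡ = apply f t , trans (cong (apply f) next≡) (concatMap-++ f (iter f n (a ∷ [])) t)

Growing : Morphism → Set
Growing f = ∀ N → ∃ λ n → ∀ m → n ≤ m → N ≤ length (iter f m (a ∷ []))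

iter-a-fixed : ∀ f → f a ≡ a ∷ [] → ∀ n → iter f n (a ∷ []) ≡ a ∷ []
iter-a-fixed f fa≡a zero = refl
iter-a-fixed f fa≡a (suc n) = trans (cong (apply f) (iter-a-fixed f fa≡a n)) (trans (apply-[_] {f} a) fa≡a)

Growing⇒fa≢a : ∀ {f} → Growing f → f a ≢ a ∷ []
Growing⇒fa≢a {f} grow fa≡a with grow 2
... | n , long with ≤-trans (long n ≤-refl) (≤-reflexive (cong length (iter-a-fixed f fa≡a n)))
...   | s≤s ()

module FixedPoint (f : Morphism) {x : InfWord} (fix : IsFixedPointFrom f x) (grow : Growing f) where

  iter-⊑ : ∀ n → iter f n (a ∷ []) ⊑ x
  iter-⊑ n = IsPrefixInf⇒⊑ _ x (fix n)

  ⊑⇒prefix-of-iter : ∀ {w} → w ⊑ x → ∃ λ n → IsPrefix w (iter f n (a ∷ []))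
  ⊑⇒prefix-of-iter {w} w⊑x with grow (length w)
  ... | n , long = n , ⊑-comparable w⊑x (iter-⊑ n) (long n ≤-refl)

  power-stable⇒periodic : ∀ z → (∀ r → ∃ λ r′ → apply f ((a ∷ z) ^ʷ r) ≡ (a ∷ z) ^ʷ r′) → IsPeriodic x
  power-stable⇒periodic z stable = a ∷ z , _ , x≗cycle
    where
    iter-prefix-of-power : ∀ n → ∃ λ r → IsPrefix (iter f n (a ∷ [])) ((a ∷ z) ^ʷ r)
    iter-prefix-of-power zero = 1 , z ++ [] , refl
    iter-prefix-of-power (suc n) with iter-prefix-of-power n
    ... | r , t , power≡ with stable r
    ...   | r′ , image≡ = r′ , apply f t , trans (sym image≡) (trans (cong (apply f) power≡) (concatMap-++ f (iter f n (a ∷ [])) t))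
    x≗cycle : ∀ k → x k ≡ cycle z k
    x≗cycle k with grow (suc k)
    ... | n , long with iter-prefix-of-power n
    ...   | r , iter⊑power = ⊑-agree (iter-⊑ n) (⊑-prefix iter⊑power (^ʷ-⊑-cycle z r)) k (long n ≤-refl)

  iter-a-then-only-b : ∀ {A'} → f a ≡ a ∷ A' → All (_≡ b) A' → All (_≡ b) (f b) →
    ∀ n → ∃ λ T → All (_≡ b) T × iter f n (a ∷ []) ≡ a ∷ T
  iter-a-then-only-b fa≡ A'-b fb-b zero = [] , [] , refl
  iter-a-then-only-b {A'} fa≡ A'-b fb-b (suc n) with iter-a-then-only-b fa≡ A'-b fb-b n
  ... | T , T-b , iter≡ = A' ++ apply f T , ++⁺ A'-b (apply-All-b f fb-b T-b) ,
                          trans (cong (apply f) iter≡) (cong (_++ apply f T) fa≡)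

  a-then-only-b : ∀ {A'} → f a ≡ a ∷ A' → All (_≡ b) A' → All (_≡ b) (f b) → ∀ {w} → a ∷ w ⊑ x → All (_≡ b) w
  a-then-only-b fa≡ A'-b fb-b a∷w⊑x with ⊑⇒prefix-of-iter a∷w⊑x
  ... | n , t , iter≡ with iter-a-then-only-b fa≡ A'-b fb-b n
  ...   | T , T-b , iter≡′ = ++⁻ˡ _ (subst (All (_≡ b)) (∷-injectiveʳ (trans (sym iter≡′) iter≡)) T-b)

-- Runs of b in Preprime words

prefix-trans : ∀ {u v w : Word} → IsPrefix u v → IsPrefix v w → IsPrefix u w
prefix-trans {u} (s , refl) (t , refl) = s ++ t , ++-assoc u s t

++-prefix : ∀ w {u v : Word} → IsPrefix u v → IsPrefix (w ++ u) (w ++ v)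
++-prefix w {u} (t , refl) = t , sym (++-assoc w u t)

apply-prefix : ∀ f {u v} → IsPrefix u v → IsPrefix (apply f u) (apply f v)
apply-prefix f {u} (t , refl) = apply f t , concatMap-++ f u t

<ᵐ-prefixes : ∀ {u v w s t} → v <ᵐ w → IsPrefix (u ++ v) s → IsPrefix (u ++ w) t → s <ᵐ t
<ᵐ-prefixes {u} v<w (s′ , refl) (t′ , refl) =
  subst₂ _<ᵐ_ (sym (++-assoc u _ s′)) (sym (++-assoc u _ t′)) (++-<ᵐ u (<ᵐ-++ s′ t′ v<w))

replicate-split : ∀ {t i} R → t < i → ∃ λ R′ → replicate i b ++ R ≡ replicate t b ++ b ∷ R′
replicate-split {zero} {suc i} R _ = replicate i b ++ R , refl
replicate-split {suc t} {suc i} R (s≤s t<i) with replicate-split R t<i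
... | R′ , eq = R′ , cong (b ∷_) eq

replicate-∷ʳ : ∀ j (c : Letter) X → replicate j c ++ c ∷ X ≡ c ∷ replicate j c ++ X
replicate-∷ʳ zero c X = refl
replicate-∷ʳ (suc j) c X = cong (c ∷_) (replicate-∷ʳ j c X)

Preprime-gap : ∀ {i t W} p E R → Preprime W → W ≡ a ∷ replicate i b ++ R →
  W ≡ p ++ a ∷ replicate t b ++ a ∷ E → NonEmpty p → i ≤ t
Preprime-gap {i} {t} p E R pre W≡ W≡′ p≢[] = ≮⇒≥ gap
  where
  gap : t < i → ⊥
  gap t<i with replicate-split R t<i
  ... | R′ , bⁱR≡ = pre p _ W≡′ p≢[]
    (subst (_ <ᵐ_) (sym (trans W≡ (cong (a ∷_) bⁱR≡))) (++-<ᵐ (a ∷ replicate t b) (here a<b)))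

Preprime-run : ∀ {i} D → Preprime (a ∷ replicate i b ++ a ∷ D) →
  ∀ j → j ≤ i → j ≤ length D → IsPrefix (replicate j b) D
Preprime-run D pre zero _ _ = D , refl
Preprime-run {i} D pre (suc j) j<i j<|D|
  with Preprime-run D pre j (≤-trans (n≤1+n j) j<i) (≤-trans (n≤1+n j) j<|D|)
... | [] , D≡ = ⊥-elim (<-irrefl refl (≤-trans j<|D| (≤-reflexive |D|≡j)))
  where
  |D|≡j : length D ≡ j
  |D|≡j = trans (cong length (trans D≡ (++-identityʳ _))) (length-replicate j)
... | b ∷ D′ , D≡ = D′ , trans D≡ (replicate-∷ʳ j b D′)
... | a ∷ D′ , D≡ = ⊥-elim (<⇒≱ j<i
  (Preprime-gap (a ∷ replicate i b) D′ (a ∷ D) pre refl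
    (cong (λ X → a ∷ replicate i b ++ a ∷ X) D≡) (λ ())))

Preprime-run-short : ∀ {i} D → Preprime (a ∷ replicate i b ++ a ∷ D) → length D ≤ i → D ≡ replicate (length D) b
Preprime-run-short D pre |D|≤i =
  sym (prefix-same-length⇒≡ (Preprime-run D pre (length D) |D|≤i ≤-refl) (length-replicate (length D)))

All-b-before-a : ∀ i X t → X ++ t ≡ replicate i b ++ a ∷ [] → NonEmpty t → All (_≡ b) X
All-b-before-a i [] t _ _ = []
All-b-before-a zero (c ∷ X) t Xt≡a t≢[] = ⊥-elim (t≢[] (++-conicalʳ X t (∷-injectiveʳ Xt≡a)))
All-b-before-a (suc i) (c ∷ X) t Xt≡ t≢[] with ∷-injective Xt≡
... | refl , Xt≡′ = refl ∷ All-b-before-a i X t Xt≡′ t≢[]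

All-b⇒replicate : ∀ {w} → All (_≡ b) w → w ≡ replicate (length w) b
All-b⇒replicate [] = refl
All-b⇒replicate (refl ∷ w-b) = cong (b ∷_) (All-b⇒replicate w-b)

#a : Word → ℕ
#a [] = 0
#a (a ∷ w) = suc (#a w)
#a (b ∷ w) = #a w

#a-++ : ∀ u v → #a (u ++ v) ≡ #a u + #a v
#a-++ [] v = refl
#a-++ (a ∷ u) v = cong suc (#a-++ u v)
#a-++ (b ∷ u) v = #a-++ u v

#a-^ʷ : ∀ z k → #a (z ^ʷ k) ≡ k * #a z
#a-^ʷ z zero = refl
#a-^ʷ z (suc k) = trans (#a-++ z (z ^ʷ k)) (cong (#a z +_) (#a-^ʷ z k))

#a-replicate-b : ∀ n → #a (replicate n b) ≡ 0
#a-replicate-b zero = refl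
#a-replicate-b (suc n) = #a-replicate-b n

power-split : ∀ v m X B → NonEmpty X → X ++ B ≡ v ^ʷ m →
  ∃ λ r → ∃₂ λ w₀ w → ∃ λ m′ → NonEmpty w₀ × v ≡ w₀ ++ w × X ≡ v ^ʷ r ++ w₀ × B ≡ w ++ v ^ʷ m′
power-split v zero X B X≢[] XB≡[] = ⊥-elim (X≢[] (++-conicalˡ X B XB≡[]))
power-split v (suc m) X B X≢[] XB≡ with ++-equidivisible X B v (v ^ʷ m) XB≡
... | inj₂ (w , v≡Xw , B≡) = 0 , X , w , m , X≢[] , v≡Xw , refl , B≡
... | inj₁ ([] , X≡v[] , vᵐ≡B) =
  0 , v , [] , m , (λ v≡[] → X≢[] (trans X≡v[] (cong (_++ []) v≡[]))) ,
  sym (++-identityʳ v) , trans X≡v[] (++-identityʳ v) , sym vᵐ≡B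
... | inj₁ (t@(_ ∷ _) , refl , vᵐ≡tB) with power-split v m t B (λ ()) (sym vᵐ≡tB)
...   | r , w₀ , w , m′ , w₀≢[] , v≡ , t≡ , B≡ =
  suc r , w₀ , w , m′ , w₀≢[] , v≡ , trans (cong (v ++_) t≡) (sym (++-assoc v (v ^ʷ r) w₀)) , B≡

ab-power-root : ∀ {v m Q} → NonEmpty v → v ^ʷ m ≡ a ∷ b ∷ Q → ∃ λ v′ → v ≡ a ∷ b ∷ v′
ab-power-root {[]} v≢[] _ = ⊥-elim (v≢[] refl)
ab-power-root {a ∷ b ∷ v′} {suc m} _ _ = v′ , refl
ab-power-root {c ∷ []} {suc zero} _ ()
ab-power-root {c ∷ []} {suc (suc m)} _ vᵐ≡ with ∷-injective vᵐ≡
... | refl , ()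
ab-power-root {a ∷ a ∷ v′} {suc m} _ ()
ab-power-root {b ∷ _ ∷ v′} {suc m} _ ()

Lyndon-ab-shape : ∀ {v r} → IsLyndon v → v ≡ a ∷ b ∷ r → v ≢ a ∷ b ∷ [] →
  ∃₂ λ k r′ → 1 ≤ k × v ≡ (a ∷ b ∷ []) ^ʷ k ++ b ∷ r′
Lyndon-ab-shape {v} {r} lyndon v≡ v≢ab = go 1 r (s≤s z≤n) v≡
  where
  ab = a ∷ b ∷ []
  go : ∀ k r → 1 ≤ k → v ≡ ab ^ʷ k ++ r → ∃₂ λ k r′ → 1 ≤ k × v ≡ ab ^ʷ k ++ b ∷ r′
  go k (b ∷ r′) 1≤k v≡ = k , r′ , 1≤k , v≡
  go (suc zero) [] _ v≡ = ⊥-elim (v≢ab (trans v≡ (++-identityʳ _)))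
  go (suc (suc k)) [] _ v≡ = ⊥-elim (Lyndon-unbordered lyndon
    ((λ ()) , ab ^ʷ suc k , (λ ()) , trans v≡ (trans (++-identityʳ _) (^ʷ-suc ab (suc k))))
    (ab ^ʷ suc k ++ [] , v≡))
  go (suc k) (a ∷ []) _ v≡ = ⊥-elim (Lyndon-unbordered lyndon
    ((λ ()) , ab ^ʷ suc k , (λ ()) , v≡) (b ∷ ab ^ʷ k ++ a ∷ [] , v≡))
  go (suc k) (a ∷ a ∷ r) _ v≡ = ⊥-elim (≺⇒≯ᵐ (proj₂ lyndon _ ((λ ()) , ab ^ʷ suc k , (λ ()) , v≡))
    (subst (a ∷ a ∷ r <ᵐ_) (sym v≡) (there (here a<b))))
  go k (a ∷ b ∷ r) 1≤k v≡ = go (suc k) r (s≤s z≤n)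
    (trans v≡ (trans (sym (++-assoc (ab ^ʷ k) ab r)) (cong (_++ r) (sym (^ʷ-suc ab k)))))

ab-gap : ∀ f {i c} → f a ≡ a ∷ b ∷ [] → b ∷ f b ≡ replicate i b ++ a ∷ replicate c b → c < i →
  ¬ Preprime (iter f 3 (a ∷ []))
ab-gap f {suc j} {c} fa≡ bfb≡ (s≤s c≤j) pre with iter-prefix-suc f fa≡ 2
... | t , N≡Vt = <⇒≱ (s≤s c≤j) (Preprime-gap p (b ∷ G) (a ∷ replicate c b ++ t) pre
                     (trans N≡Vt (trans (cong (_++ t) V≡) (++-assoc (a ∷ replicate (suc j) b) _ t))) N≡ (λ ()))
  where
  open ≡-Reasoning
  fb≡ : f b ≡ replicate j b ++ a ∷ replicate c b
  fb≡ = ∷-injectiveʳ bfb≡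
  F = apply f (replicate j b)
  G = apply f (replicate c b)
  p = a ∷ b ∷ F ++ replicate j b
  V≡ : iter f 2 (a ∷ []) ≡ a ∷ replicate (suc j) b ++ a ∷ replicate c b
  V≡ = begin
    apply f (f a ++ [])           ≡⟨ cong (apply f) (trans (++-identityʳ (f a)) fa≡) ⟩
    f a ++ f b ++ []              ≡⟨ cong (_++ f b ++ []) fa≡ ⟩
    a ∷ b ∷ f b ++ []             ≡⟨ cong (λ w → a ∷ b ∷ w) (trans (++-identityʳ (f b)) fb≡) ⟩
    a ∷ replicate (suc j) b ++ a ∷ replicate c b ∎
  N≡ : iter f 3 (a ∷ []) ≡ p ++ a ∷ replicate c b ++ a ∷ b ∷ G
  N≡ = begin
    apply f (iter f 2 (a ∷ []))
      ≡⟨ cong (apply f) (trans V≡ (cong (a ∷_) (sym (replicate-∷ʳ j b (a ∷ replicate c b))))) ⟩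
    f a ++ apply f (replicate j b ++ b ∷ a ∷ replicate c b)
      ≡⟨ cong₂ _++_ fa≡ (concatMap-++ f (replicate j b) (b ∷ a ∷ replicate c b)) ⟩
    a ∷ b ∷ F ++ f b ++ f a ++ G
      ≡⟨ cong₂ (λ u w → a ∷ b ∷ F ++ u ++ w ++ G) fb≡ fa≡ ⟩
    a ∷ b ∷ F ++ (replicate j b ++ a ∷ replicate c b) ++ a ∷ b ∷ G
      ≡⟨ cong (λ w → a ∷ b ∷ F ++ w) (++-assoc (replicate j b) (a ∷ replicate c b) (a ∷ b ∷ G)) ⟩
    a ∷ b ∷ F ++ replicate j b ++ a ∷ replicate c b ++ a ∷ b ∷ G
      ≡⟨ cong (λ w → a ∷ b ∷ w) (sym (++-assoc F (replicate j b) _)) ⟩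
    p ++ a ∷ replicate c b ++ a ∷ b ∷ G ∎

-- The square f(a bⁱ)² is a prefix of f³(a)

module SquareOfImage (f : Morphism) {A'} (fa≡ : f a ≡ a ∷ A') (A'≢[] : NonEmpty A')
  {x : InfWord} (fix : IsFixedPointFrom f x) (grow : Growing f)
  (N-preprime : Preprime (iter f 3 (a ∷ [])))
  {i : ℕ} (H⊑x : a ∷ replicate i b ++ a ∷ [] ⊑ x) where

  open FixedPoint f fix grow

  H V P : Word
  H = a ∷ replicate i b ++ a ∷ []
  V = iter f 2 (a ∷ [])
  P = apply f (a ∷ replicate i b)

  H++≡ : ∀ D → H ++ D ≡ a ∷ replicate i b ++ a ∷ D
  H++≡ D = cong (a ∷_) (++-assoc (replicate i b) (a ∷ []) D)

  V≡ : V ≡ a ∷ A' ++ apply f A'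
  V≡ = trans (cong (apply f) (trans (++-identityʳ (f a)) fa≡)) (cong (_++ apply f A') fa≡)

  V-preprime : Preprime V
  V-preprime = Preprime-prefix (iter-prefix-suc f fa≡ 2) N-preprime

  fa⊑x : f a ⊑ x
  fa⊑x = ⊑-prefix ([] , refl) (iter-⊑ 1)

  i≤|H| : i ≤ length H
  i≤|H| = ≤-trans (≤-trans (≤-reflexive (sym (length-replicate i))) (length-++-≤ˡ (replicate i b))) (n≤1+n _)

  H≤V : length H ≤ length V
  H≤V = ≮⇒≥ V-short-absurd
    where
    V-short-absurd : length V < length H → ⊥
    V-short-absurd |V|<|H| with proper-prefix (⊑-comparable (iter-⊑ 2) H⊑x (<⇒≤ |V|<|H|)) |V|<|H|
    ... | t , t≢[] , H≡Vt = not-all-b (a-then-only-b fa≡ A'-b fb-b H⊑x)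
      where
      A'fA'-b : All (_≡ b) (A' ++ apply f A')
      A'fA'-b = All-b-before-a i _ t (sym (∷-injectiveʳ (trans H≡Vt (cong (_++ t) V≡)))) t≢[]
      A'-b : All (_≡ b) A'
      A'-b = ++⁻ˡ A' A'fA'-b
      fb-b : All (_≡ b) (f b)
      fb-b = All-b-apply⁻ f A'≢[] A'-b (++⁻ʳ A' A'fA'-b)
      not-all-b : ¬ All (_≡ b) (replicate i b ++ a ∷ [])
      not-all-b bs with ++⁻ʳ (replicate i b) bs
      ... | () ∷ _

  V-long-if-fa-long : length H ≤ length (f a) → length H + i ≤ length V
  V-long-if-fa-long |H|≤|fa| with ⊑-comparable H⊑x fa⊑x |H|≤|fa|
  ... | t , fa≡Ht = begin
    length H + i                 ≤⟨ +-monoʳ-≤ (length H) i≤|H| ⟩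
    length H + length H          ≤⟨ +-mono-≤ |H|≤|fa| |H|≤|fa| ⟩
    length (f a) + length (f a)  ≤⟨ +-monoʳ-≤ (length (f a)) fa≤tail ⟩
    length (f a) + length (apply f (replicate i b ++ a ∷ []))  ≡⟨ length-++ (f a) ⟨
    length (apply f H)           ≤⟨ prefix-length (apply-prefix f (t , fa≡Ht)) ⟩
    length (apply f (f a))       ≡⟨ cong (length ∘ apply f) (++-identityʳ (f a)) ⟨
    length V                     ∎
    where
    open ≤-Reasoning
    fa≤tail : length (f a) ≤ length (apply f (replicate i b ++ a ∷ []))
    fa≤tail = ≤-trans (≤-reflexive (cong length (sym (++-identityʳ (f a)))))
                (≤-trans (length-++-≤ʳ (f a ++ []) {apply f (replicate i b)}) (≤-reflexive (cong length (sym (concatMap-++ f (replicate i b) (a ∷ []))))))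

  fa-short⇒A'-b : length (f a) < length H → All (_≡ b) A'
  fa-short⇒A'-b |fa|<|H| with proper-prefix (⊑-comparable fa⊑x H⊑x (<⇒≤ |fa|<|H|)) |fa|<|H|
  ... | t , t≢[] , H≡fat = All-b-before-a i A' t (sym (∷-injectiveʳ (trans H≡fat (cong (_++ t) fa≡)))) t≢[]

  fa-short-D-short-absurd : All (_≡ b) A' → ∀ D → V ≡ H ++ D → length D < i → ⊥
  fa-short-D-short-absurd A'-b D V≡HD |D|<i = ab-gap f fa≡ab bfb≡ |D|<i N-preprime
    where
    c = length D
    k = length A'
    D≡ : D ≡ replicate c b
    D≡ = Preprime-run-short D (subst Preprime (trans V≡HD (H++≡ D)) V-preprime) (<⇒≤ |D|<i)
    bᵏfbᵏ≡ : replicate k b ++ f b ^ʷ k ≡ replicate i b ++ a ∷ replicate c b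
    bᵏfbᵏ≡ = begin
      replicate k b ++ f b ^ʷ k            ≡⟨ cong (replicate k b ++_) (sym (apply-replicate f b k)) ⟩
      replicate k b ++ apply f (replicate k b) ≡⟨ cong (λ w → w ++ apply f w) (sym A'≡) ⟩
      A' ++ apply f A'                      ≡⟨ ∷-injectiveʳ (trans (sym V≡) (trans V≡HD (trans (H++≡ D) (cong (λ w → a ∷ replicate i b ++ a ∷ w) D≡)))) ⟩
      replicate i b ++ a ∷ replicate c b    ∎
      where
      open ≡-Reasoning
      A'≡ : A' ≡ replicate k b
      A'≡ = All-b⇒replicate A'-b
    k≡1 : k ≡ 1
    k≡1 = m*n≡1⇒m≡1 k (#a (f b)) (begin
      k * #a (f b)                                 ≡⟨ #a-^ʷ (f b) k ⟨
      #a (f b ^ʷ k)                                ≡⟨ cong (_+ #a (f b ^ʷ k)) (#a-replicate-b k) ⟨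
      #a (replicate k b) + #a (f b ^ʷ k)           ≡⟨ #a-++ (replicate k b) _ ⟨
      #a (replicate k b ++ f b ^ʷ k)               ≡⟨ cong #a bᵏfbᵏ≡ ⟩
      #a (replicate i b ++ a ∷ replicate c b)      ≡⟨ #a-++ (replicate i b) _ ⟩
      #a (replicate i b) + suc (#a (replicate c b)) ≡⟨ cong₂ (λ m n → m + suc n) (#a-replicate-b i) (#a-replicate-b c) ⟩
      1                                            ∎)
      where open ≡-Reasoning
    A'≡b : A' ≡ b ∷ []
    A'≡b = trans (All-b⇒replicate A'-b) (cong (λ n → replicate n b) k≡1)
    fa≡ab : f a ≡ a ∷ b ∷ []
    fa≡ab = trans fa≡ (cong (a ∷_) A'≡b)
    bfb≡ : b ∷ f b ≡ replicate i b ++ a ∷ replicate c b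
    bfb≡ = trans (cong (b ∷_) (sym (++-identityʳ (f b))))
             (trans (cong (λ n → replicate n b ++ f b ^ʷ n) (sym k≡1)) bᵏfbᵏ≡)

  -- Either f(a) is long, and then so is f²(a) ⊇ f(a bⁱ a); or f(a) = a bᵏ, and a
  -- short tail D = bᶜ forces f(a) = ab and f(b) = bⁱ⁻¹ a bᶜ (count the letters a),
  -- which ab-gap rules out.
  D-long : ∀ D → V ≡ H ++ D → i ≤ length D
  D-long D V≡HD = ≮⇒≥ D-short-absurd
    where
    |V|≡ : length V ≡ length H + length D
    |V|≡ = trans (cong length V≡HD) (length-++ H)
    D-short-absurd : length D < i → ⊥
    D-short-absurd |D|<i with length H ≤? length (f a)
    ... | yes |H|≤|fa| = <⇒≱ (+-monoʳ-< (length H) |D|<i) (subst (length H + i ≤_) |V|≡ (V-long-if-fa-long |H|≤|fa|))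
    ... | no |H|≰|fa| = fa-short-D-short-absurd (fa-short⇒A'-b (≰⇒> |H|≰|fa|)) D V≡HD |D|<i

  square-prefix : IsPrefix ((a ∷ replicate i b) ++ (a ∷ replicate i b)) V
  square-prefix with ⊑-comparable H⊑x (iter-⊑ 2) H≤V
  ... | D , V≡HD with Preprime-run D (subst Preprime (trans V≡HD (H++≡ D)) V-preprime) i ≤-refl (D-long D V≡HD)
  ...   | R , D≡ = R , trans V≡HD (trans (H++≡ D) (trans (cong (λ w → a ∷ replicate i b ++ a ∷ w) D≡)
                   (cong (a ∷_) (sym (++-assoc (replicate i b) _ R)))))

  P-Lyndon-power : ∃ λ v → IsLyndon v × IsPowerOf P v
  P-Lyndon-power = square-Preprime⇒Lyndon-power P P≢[] (Preprime-prefix PP-prefix N-preprime)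
    where
    PP-prefix : IsPrefix (P ++ P) (iter f 3 (a ∷ []))
    PP-prefix = subst (λ w → IsPrefix w (apply f V)) (concatMap-++ f (a ∷ replicate i b) _) (apply-prefix f square-prefix)
    P≢[] : NonEmpty P
    P≢[] = ++-nonEmptyˡ (f a) _ (subst NonEmpty (sym fa≡) λ ())

  root≢ab^i : ¬ IsPeriodic x → ∀ {v} → IsPowerOf P v → v ≢ a ∷ replicate i b
  root≢ab^i aperiodic (m , _ , P≡vᵐ) refl = aperiodic (power-stable⇒periodic (replicate i b) λ r →
    r * m , trans (apply-^ʷ f _ r) (trans (cong (_^ʷ r) P≡vᵐ) (^ʷ-* _ m r)))

-- The case i = 1

module RootLongerThanFb (f : Morphism) {A''} (fa≡ : f a ≡ a ∷ b ∷ A'')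
  {x : InfWord} (fix : IsFixedPointFrom f x) (grow : Growing f) (aperiodic : ¬ IsPeriodic x)
  (N-preprime : Preprime (iter f 3 (a ∷ [])))
  {v} (lyndon : IsLyndon v) (v≢ab : v ≢ a ∷ b ∷ []) {m} (P≡ : apply f (a ∷ b ∷ []) ≡ v ^ʷ suc m) where

  open FixedPoint f fix grow
  open ≡-Reasoning

  ab V : Word
  ab = a ∷ b ∷ []
  V = iter f 2 (a ∷ [])

  fa++fb≡ : f a ++ f b ≡ v ^ʷ suc m
  fa++fb≡ = trans (cong (f a ++_) (sym (++-identityʳ (f b)))) P≡

  V≡ : V ≡ f a ++ f b ++ apply f A''
  V≡ = cong (apply f) (trans (++-identityʳ (f a)) fa≡)

  v-starts-ab : ∃ λ v′ → v ≡ a ∷ b ∷ v′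
  v-starts-ab = ab-power-root {m = suc m} (proj₁ lyndon) (trans (sym fa++fb≡) (cong (_++ f b) fa≡))

  v-prefix-V : IsPrefix v V
  v-prefix-V = v ^ʷ m ++ apply f A'' , (begin
    V                                   ≡⟨ V≡ ⟩
    f a ++ f b ++ apply f A''           ≡⟨ ++-assoc (f a) (f b) _ ⟨
    (f a ++ f b) ++ apply f A''         ≡⟨ cong (_++ apply f A'') fa++fb≡ ⟩
    (v ++ v ^ʷ m) ++ apply f A''        ≡⟨ ++-assoc v (v ^ʷ m) _ ⟩
    v ++ v ^ʷ m ++ apply f A''          ∎)

  -- f³(a) begins with f(v) = v^(km) w ⋯, while after f(f(a) w′) w it continues
  -- with v^(m′+1) f(v) = v^(km) v ⋯.
  b-ending-absurd : ∀ {w₀ w′ m′} → NonEmpty w₀ → v ≡ w₀ ++ (w′ ∷ʳ b) → f b ≡ (w′ ∷ʳ b) ++ v ^ʷ suc m′ → ⊥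
  b-ending-absurd {w₀} {w′} {m′} w₀≢[] v≡w₀w fb≡ with Lyndon-ab-shape lyndon (proj₂ v-starts-ab) v≢ab
  ... | k , r′ , _ , v≡abᵏbr′ = N-preprime p S N≡pS p≢[] (<ᵐ-prefixes v<w S-prefix N-prefix)
    where
    w = w′ ∷ʳ b
    km = k * suc m
    v<w : v <ᵐ w
    v<w = Lyndon-<ᵐ-suffix lyndon (∷ʳ-nonEmpty w′ b , w₀ , w₀≢[] , v≡w₀w)
    fv-prefix : IsPrefix (v ^ʷ km ++ w) (apply f v)
    fv-prefix = v ^ʷ suc m′ ++ apply f r′ , (begin
      apply f v                                     ≡⟨ cong (apply f) v≡abᵏbr′ ⟩
      apply f (ab ^ʷ k ++ b ∷ r′)                   ≡⟨ concatMap-++ f (ab ^ʷ k) (b ∷ r′) ⟩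
      apply f (ab ^ʷ k) ++ f b ++ apply f r′        ≡⟨ cong₂ (λ u w → u ++ w ++ apply f r′) fabᵏ≡ fb≡ ⟩
      v ^ʷ km ++ (w ++ v ^ʷ suc m′) ++ apply f r′   ≡⟨ cong (v ^ʷ km ++_) (++-assoc w _ _) ⟩
      v ^ʷ km ++ w ++ v ^ʷ suc m′ ++ apply f r′     ≡⟨ ++-assoc (v ^ʷ km) w _ ⟨
      (v ^ʷ km ++ w) ++ v ^ʷ suc m′ ++ apply f r′   ∎)
      where
      fabᵏ≡ : apply f (ab ^ʷ k) ≡ v ^ʷ km
      fabᵏ≡ = trans (apply-^ʷ f ab k) (trans (cong (_^ʷ k) P≡) (^ʷ-* v (suc m) k))
    N-prefix : IsPrefix (v ^ʷ km ++ w) (iter f 3 (a ∷ []))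
    N-prefix = prefix-trans fv-prefix (apply-prefix f v-prefix-V)
    X = v ^ʷ suc m′ ++ apply f A''
    p = apply f (f a ++ w′) ++ w
    S = v ^ʷ suc m′ ++ apply f X
    p≢[] : NonEmpty p
    p≢[] = ++-nonEmptyʳ (apply f (f a ++ w′)) w (∷ʳ-nonEmpty w′ b)
    N≡pS : iter f 3 (a ∷ []) ≡ p ++ S
    N≡pS = begin
      apply f V                                         ≡⟨ cong (apply f) V≡′ ⟩
      apply f ((f a ++ w′) ++ b ∷ X)                    ≡⟨ concatMap-++ f (f a ++ w′) (b ∷ X) ⟩
      apply f (f a ++ w′) ++ f b ++ apply f X           ≡⟨ cong (λ u → apply f (f a ++ w′) ++ u ++ apply f X) fb≡ ⟩
      apply f (f a ++ w′) ++ (w ++ v ^ʷ suc m′) ++ apply f X ≡⟨ cong (apply f (f a ++ w′) ++_) (++-assoc w _ _) ⟩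
      apply f (f a ++ w′) ++ w ++ S                     ≡⟨ ++-assoc (apply f (f a ++ w′)) w S ⟨
      p ++ S                                            ∎
      where
      V≡′ : V ≡ (f a ++ w′) ++ b ∷ X
      V≡′ = begin
        V                               ≡⟨ V≡ ⟩
        f a ++ f b ++ apply f A''       ≡⟨ cong (λ u → f a ++ u ++ apply f A'') fb≡ ⟩
        f a ++ (w ++ v ^ʷ suc m′) ++ apply f A''  ≡⟨ cong (f a ++_) (trans (++-assoc w _ _) (++-assoc w′ (b ∷ []) X)) ⟩
        f a ++ w′ ++ b ∷ X              ≡⟨ ++-assoc (f a) w′ _ ⟨
        (f a ++ w′) ++ b ∷ X            ∎
    S-prefix : IsPrefix (v ^ʷ km ++ v) S
    S-prefix = prefix-trans (v ^ʷ m′ , powers≡) (++-prefix (v ^ʷ suc m′) vᵏᵐ-prefix)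
      where
      vᵏᵐ-prefix : IsPrefix (v ^ʷ km) (apply f X)
      vᵏᵐ-prefix = prefix-trans (w , refl)
        (prefix-trans fv-prefix (apply-prefix f {v} (v ^ʷ m′ ++ apply f A'' , ++-assoc v (v ^ʷ m′) _)))
      powers≡ : v ^ʷ suc m′ ++ v ^ʷ km ≡ (v ^ʷ km ++ v) ++ v ^ʷ m′
      powers≡ = begin
        v ^ʷ suc m′ ++ v ^ʷ km   ≡⟨ ^ʷ-+ v (suc m′) km ⟨
        v ^ʷ (suc m′ + km)       ≡⟨ cong (v ^ʷ_) (+-comm (suc m′) km) ⟩
        v ^ʷ (km + suc m′)       ≡⟨ ^ʷ-+ v km (suc m′) ⟩
        v ^ʷ km ++ v ++ v ^ʷ m′  ≡⟨ ++-assoc (v ^ʷ km) v _ ⟨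
        (v ^ʷ km ++ v) ++ v ^ʷ m′ ∎

  fb<v : length (f b) < length v
  fb<v = ≰⇒> v≤fb-absurd
    where
    fa≢[] : NonEmpty (f a)
    fa≢[] = subst NonEmpty (sym fa≡) λ ()
    v≤fb-absurd : length v ≤ length (f b) → ⊥
    v≤fb-absurd v≤fb with power-split v (suc m) (f a) (f b) fa≢[] fa++fb≡
    ... | r , w₀ , w , m′ , w₀≢[] , v≡w₀w , fa≡vʳw₀ , fb≡wvᵐ′ with initLast w
    ...   | [] = aperiodic (power-stable⇒periodic (b ∷ proj₁ v-starts-ab)
                   (subst (λ u → ∀ n → ∃ λ n′ → apply f (u ^ʷ n) ≡ u ^ʷ n′) (proj₂ v-starts-ab)
                          (apply-power f v images ∘ (v ^ʷ_))))
      where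
      images : ∀ c → ∃ λ n → f c ≡ v ^ʷ n
      images a = suc r , trans fa≡vʳw₀ (trans (cong (v ^ʷ r ++_) (trans (sym (++-identityʳ w₀)) (sym v≡w₀w))) (sym (^ʷ-suc v r)))
      images b = m′ , fb≡wvᵐ′
    ...   | w′ ∷ʳ′ a = Lyndon-unbordered lyndon
                         ((λ ()) , w₀ ++ w′ , ++-nonEmptyˡ w₀ w′ w₀≢[] , trans v≡w₀w (sym (++-assoc w₀ w′ (a ∷ []))))
                         (b ∷ proj₁ v-starts-ab , proj₂ v-starts-ab)
    ...   | w′ ∷ʳ′ b with m′
    ...     | suc m″ = b-ending-absurd {m′ = m″} w₀≢[] v≡w₀w fb≡wvᵐ′
    ...     | zero = <⇒≱ (subst (_< length v) (cong length (sym (trans fb≡wvᵐ′ (++-identityʳ _))))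
                            (suffix-shorter (∷ʳ-nonEmpty w′ b , w₀ , w₀≢[] , v≡w₀w))) v≤fb

root-longer-than-fb : ∀ f {A'} → f a ≡ a ∷ A' → NonEmpty A' → ∀ {x} → IsFixedPointFrom f x → Growing f →
  ¬ IsPeriodic x → Preprime (iter f 3 (a ∷ [])) → ∀ {i} → i ≡ 1 → a ∷ replicate i b ++ a ∷ [] ⊑ x →
  ∀ {v} → IsLyndon v → IsPowerOf (apply f (a ∷ replicate i b)) v → v ≢ a ∷ replicate i b →
  length (f b) < length v
root-longer-than-fb f {[]} _ A'≢[] _ _ _ _ _ _ _ _ _ = ⊥-elim (A'≢[] refl)
root-longer-than-fb f {c ∷ A''} fa≡ _ {x} fix grow aperiodic N-preprime refl (_ , x₁≡b , _) lyndon (suc m , _ , P≡) v≢ab =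
  RootLongerThanFb.fb<v f (trans fa≡ (cong (λ d → a ∷ d ∷ A'') c≡b)) fix grow aperiodic N-preprime lyndon v≢ab {m} P≡
  where
  c≡b : c ≡ b
  c≡b with subst (_⊑ x) fa≡ (⊑-prefix ([] , refl) (FixedPoint.iter-⊑ f fix grow 1))
  ... | _ , x₁≡c , _ = trans (sym x₁≡c) x₁≡b

lemma6 : (f : Morphism) → Prolongable f
    → (x : InfWord) → IsFixedPointFrom f x
    → (∃ λ L → IsLyndon L × IsPrefix (iter f 3 (a ∷ [])) L)
    → (i : ℕ) → 1 ≤ i → IsPrefixInf (a ∷ replicate i b ++ a ∷ []) x
    → ¬ IsPeriodic x
    → ∃ λ u → IsLyndon u × IsPowerOf (apply f (a ∷ replicate i b)) u
        × u ≢ a ∷ replicate i b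
        × (i ≡ 1 → length (f b) < length u)
lemma6 f ((A' , fa≡) , grow) x fix (L , lyndon-L , N⊑L) i _ H≤x aperiodic = conclude P-Lyndon-power
  where
  A'≢[] : NonEmpty A'
  A'≢[] A'≡[] = Growing⇒fa≢a grow (trans fa≡ (cong (a ∷_) A'≡[]))
  N-preprime : Preprime (iter f 3 (a ∷ []))
  N-preprime = Preprime-prefix N⊑L (Lyndon⇒Preprime lyndon-L)
  H⊑x : a ∷ replicate i b ++ a ∷ [] ⊑ x
  H⊑x = IsPrefixInf⇒⊑ _ x H≤x
  open SquareOfImage f fa≡ A'≢[] fix grow N-preprime H⊑x
  conclude : (∃ λ v → IsLyndon v × IsPowerOf P v) →
    ∃ λ u → IsLyndon u × IsPowerOf P u × u ≢ a ∷ replicate i b × (i ≡ 1 → length (f b) < length u)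
  conclude (v , lyndon , P≡vᵐ) =
    v , lyndon , P≡vᵐ , v≢ab^i ,
    λ i≡1 → root-longer-than-fb f fa≡ A'≢[] fix grow aperiodic N-preprime i≡1 H⊑x lyndon P≡vᵐ v≢ab^i
    where
    v≢ab^i : v ≢ a ∷ replicate i b
    v≢ab^i = root≢ab^i aperiodic P≡vᵐ
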